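{- Let $B$ be a board and let $\mathcal{C}$ be a saturated domino covering of $B$. Form the graph $\Gamma$ whose vertex set is the set of cells of $B$, two cells being joined by an edge if some domino of $\mathcal{C}$ consists of exactly these two cells. Then the vertex set of every connected component of $\Gamma$ is a fragment. Consequently, $\mathcal{C}$ determines a decomposition of the cells of $B$ into pairwise non-overlapping fragments.
   Context: Work in the square grid: cells are the unit squares of the plane with integer corners, and two cells are neighbors (adjacent) if they share an edge. A board is a finite set $B$ of cells such that every cell of $B$ has at least one neighbor in $B$. A domino is a set of two adjacent cells. A domino covering of $B$ is a finite collection (repetitions allowed) of dominoes, each contained in $B$, whose union is $B$. It is saturated if removing any single domino from the collection leaves some cell of $B$ uncovered. An X-pentomino is a set consisting of a cell together with its four neighbors. A fragment is a set of cells consisting of a cell $c$ together with a nonempty subset of the four neighbors of $c$; equivalently, a connected subset of an X-pentomino having at least two cells. (Up to rotation the fragments are the domino, the straight and the L-shaped trominoes, the T-tetromino and the X-pentomino.) -}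

module Defs where

open import Data.Integer using (ℤ; _+_; 1ℤ; -1ℤ)
open import Data.Product using (Σ; ∃; ∃-syntax; _×_; _,_; proj₁; proj₂)
open import Data.Sum using (_⊎_)
open import Data.List using (List; length; lookup; removeAt)
open import Data.List.Membership.Propositional using (_∈_)
open import Data.Fin using (Fin)
open import Relation.Nullary using (¬_)
open import Relation.Binary.PropositionalEquality using (_≡_)
open import Relation.Binary.Construct.Closure.ReflexiveTransitive using (Star)

-- A cell is identified with its lower-left integer corner.
Cell : Set
Cell = ℤ × ℤ

Adj : Cell → Cell → Set
Adj (x , y) (x' , y') =
  ((x' ≡ x + 1ℤ) × (y' ≡ y)) ⊎ ((x' ≡ x + -1ℤ) × (y' ≡ y)) ⊎
  ((x' ≡ x) × (y' ≡ y + 1ℤ)) ⊎ ((x' ≡ x) × (y' ≡ y + -1ℤ))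

IsBoard : List Cell → Set
IsBoard B = ∀ c → c ∈ B → ∃[ d ] (d ∈ B × Adj c d)

Domino : Set
Domino = Σ (Cell × Cell) λ p → Adj (proj₁ p) (proj₂ p)

InDomino : Cell → Domino → Set
InDomino c ((a , b) , _) = (c ≡ a) ⊎ (c ≡ b)

Covered : List Domino → Cell → Set
Covered C c = ∃[ D ] (D ∈ C × InDomino c D)

IsCovering : List Cell → List Domino → Set
IsCovering B C =
  (∀ D → D ∈ C → ∀ c → InDomino c D → c ∈ B) ×
  (∀ c → c ∈ B → Covered C c)

-- Saturated: removing any single domino (one entry of the collection)
-- leaves some cell of B uncovered.
IsSaturated : List Cell → List Domino → Set
IsSaturated B C = ∀ (i : Fin (length C)) → ∃[ c ] (c ∈ B × ¬ Covered (removeAt C i) c)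

Edge : List Domino → Cell → Cell → Set
Edge C c d = ∃[ D ] (D ∈ C × ((proj₁ (proj₁ D) ≡ c × proj₂ (proj₁ D) ≡ d) ⊎
                              (proj₁ (proj₁ D) ≡ d × proj₂ (proj₁ D) ≡ c)))

Connected : List Domino → Cell → Cell → Set
Connected C = Star (Edge C)

Component : List Domino → Cell → Cell → Set
Component C c d = Connected C c d

IsFragment : (Cell → Set) → Set
IsFragment F = ∃[ x ] (F x × (∀ d → F d → (d ≡ x) ⊎ Adj x d) × ∃[ d ] (F d × Adj x d))

IsFragmentDecomposition : List Cell → List (Cell → Set) → Set
IsFragmentDecomposition B L =
  (∀ i → IsFragment (lookup L i)) ×
  (∀ i c → lookup L i c → c ∈ B) ×
  (∀ c → c ∈ B → ∃[ i ] lookup L i c) ×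
  (∀ i j c → lookup L i c → lookup L j c → i ≡ j)

-- Saturation means that every domino of the collection covers a cell covered by no
-- other domino; in Γ that cell is a vertex whose only neighbour is the other cell of
-- the domino.  In a graph where every edge has such a pendant endpoint, the neighbour x
-- of a pendant vertex is the centre of a star: for an edge x – y, either y is pendant,
-- or x is, and then y is the pendant vertex we started from.  So every walk from x of
-- length two returns to x, each component is a star, and a star in the grid is a
-- fragment.  Components have diameter at most two, which makes connectivity decidable,
-- so deduplicating the cells of B up to connectivity lists each component once.
module Submission where

open import Level using (Level; 0ℓ)
open import Data.Empty using (⊥-elim)
open import Data.Fin using (zero; suc)
open import Data.Integer using (_+_; 1ℤ; -1ℤ)
import Data.Integer as ℤ
open import Data.Integer.Properties using (+-assoc; +-identityʳ)
open import Data.List using (List; _∷_; lookup; removeAt; map; deduplicate)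
open import Data.List.Membership.Propositional using (_∈_; find; lose)
open import Data.List.Membership.Propositional.Properties using (∈-lookup)
import Data.List.Relation.Unary.All as All
open import Data.List.Relation.Unary.AllPairs as AllPairs using (AllPairs; _∷_)
import Data.List.Relation.Unary.AllPairs.Properties as AllPairsₚ
open import Data.List.Relation.Unary.Any as Any using (Any; here; there; any?)
import Data.List.Relation.Unary.Any.Properties as Anyₚ
open import Data.List.Relation.Unary.Unique.DecSetoid.Properties using (deduplicate-!)
open import Data.Product using (_×_; ∃-syntax; _,_; proj₁; proj₂; map₂)
open import Data.Product.Properties using (≡-dec)
open import Data.Sum using (_⊎_; inj₁; inj₂)
import Data.Sum as Sum
open import Function using (_∘_; _∘₂_)
open import Relation.Binary using (Rel; Symmetric; Decidable; DecidableEquality; _⇒_)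
open import Relation.Binary.Bundles using (DecSetoid)
open import Relation.Binary.Construct.Closure.ReflexiveTransitive using (Star; ε; _◅_; _◅◅_; reverse)
open import Relation.Binary.PropositionalEquality using (_≡_; refl; cong; subst)
import Relation.Binary.PropositionalEquality as ≡
open import Relation.Nullary using (¬_; Dec)
open import Relation.Nullary.Decidable using (map′; _×-dec_; _⊎-dec_)
open import Relation.Unary using (Pred; _≬_)

open import Defs

private
  variable
    a b ℓ : Level
    A : Set a

∈-removeAt⁻ : ∀ {y} {xs : List A} → y ∈ xs → ∀ i → y ≡ lookup xs i ⊎ y ∈ removeAt xs i
∈-removeAt⁻ (here y≡x)  zero    = inj₁ y≡x
∈-removeAt⁻ (there y∈xs) zero    = inj₂ y∈xs
∈-removeAt⁻ (here y≡x)  (suc i) = inj₂ (here y≡x)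
∈-removeAt⁻ (there y∈xs) (suc i) = Sum.map₂ there (∈-removeAt⁻ y∈xs i)

AllPairs-disjoint⇒lookup-injective : ∀ {Ps : List (Pred A ℓ)} → AllPairs (λ P Q → ¬ P ≬ Q) Ps →
  ∀ i j → lookup Ps i ≬ lookup Ps j → i ≡ j
AllPairs-disjoint⇒lookup-injective (_ ∷ _) zero zero _ = refl
AllPairs-disjoint⇒lookup-injective (P#Ps ∷ _) zero (suc j) P≬Q =
  ⊥-elim (All.lookup P#Ps (∈-lookup j) P≬Q)
AllPairs-disjoint⇒lookup-injective (P#Ps ∷ _) (suc i) zero (x , Qx , Px) =
  ⊥-elim (All.lookup P#Ps (∈-lookup i) (x , Px , Qx))
AllPairs-disjoint⇒lookup-injective (_ ∷ Ps#) (suc i) (suc j) P≬Q =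
  cong suc (AllPairs-disjoint⇒lookup-injective Ps# i j P≬Q)

module EquivalenceClasses (S : DecSetoid a ℓ) where

  open DecSetoid S

  classes : List Carrier → List (Pred Carrier ℓ)
  classes xs = map _≈_ (deduplicate _≟_ xs)

  classes-represented : ∀ xs i → ∃[ r ] (r ∈ xs × lookup (classes xs) i ≡ _≈_ r)
  classes-represented xs i with find (Anyₚ.map⁻ (∈-lookup {xs = classes xs} i))
  ... | r , r∈reps , eq = r , Anyₚ.deduplicate⁻ _≟_ r∈reps , eq

  classes-cover : ∀ {x xs} → x ∈ xs → ∃[ i ] lookup (classes xs) i x
  classes-cover {x} {xs} x∈xs = Any.index x∈classes , Anyₚ.lookup-index x∈classes
    where
    x∈classes : Any (λ P → P x) (classes xs)
    x∈classes = Anyₚ.map⁺ (Anyₚ.deduplicate⁺ _≟_ (λ y≈z z≈x → trans y≈z z≈x)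
                                         (Any.map (reflexive ∘ ≡.sym) x∈xs))

  classes-disjoint : ∀ xs i j x → lookup (classes xs) i x → lookup (classes xs) j x → i ≡ j
  classes-disjoint xs i j x xᵢ xⱼ =
    AllPairs-disjoint⇒lookup-injective
      (AllPairsₚ.map⁺ (AllPairs.map disjoint (deduplicate-! S xs))) i j (x , xᵢ , xⱼ)
    where
    disjoint : ∀ {r s} → ¬ r ≈ s → ¬ _≈_ r ≬ _≈_ s
    disjoint r≉s (_ , r≈y , s≈y) = r≉s (trans r≈y (sym s≈y))

module _ (E : Rel A ℓ) where

  OnlyNeighbour : A → A → Set _
  OnlyNeighbour u v = ∀ {w} → E u w → w ≡ v

  IsStarCentre : A → Set _
  IsStarCentre x = ∀ {y} → E x y → OnlyNeighbour y x

  ClosedNbhd : A → A → Set _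
  ClosedNbhd x d = d ≡ x ⊎ E x d

  IsStar : Pred A b → Set _
  IsStar F = ∃[ x ] (F x × (∀ d → F d → ClosedNbhd x d) × ∃[ d ] (F d × E x d))

  WithinTwoSteps : A → A → Set _
  WithinTwoSteps u v = u ≡ v ⊎ E u v ⊎ ∃[ y ] (E u y × E y v)

  withinTwoSteps⇒Star : ∀ {u v} → WithinTwoSteps u v → Star E u v
  withinTwoSteps⇒Star (inj₁ refl)                 = ε
  withinTwoSteps⇒Star (inj₂ (inj₁ uv))            = uv ◅ ε
  withinTwoSteps⇒Star (inj₂ (inj₂ (_ , uy , yv))) = uy ◅ yv ◅ ε

  Star-preserves-ClosedNbhd : ∀ {x s d} → IsStarCentre x → ClosedNbhd x s → Star E s d → ClosedNbhd x d
  Star-preserves-ClosedNbhd centre s∈N ε                = s∈N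
  Star-preserves-ClosedNbhd centre (inj₁ refl) (xy ◅ w) = Star-preserves-ClosedNbhd centre (inj₂ xy) w
  Star-preserves-ClosedNbhd centre (inj₂ xs) (sy ◅ w)   = Star-preserves-ClosedNbhd centre (inj₁ (centre xs sy)) w

IsStar-mono : ∀ {E : Rel A a} {E′ : Rel A b} {F : Pred A ℓ} → E ⇒ E′ → IsStar E F → IsStar E′ F
IsStar-mono E⇒E′ (x , Fx , near , d , Fd , xd) = x , Fx , Sum.map₂ E⇒E′ ∘₂ near , d , Fd , E⇒E′ xd

module PendantEdges {E : Rel A ℓ} (E-sym : Symmetric E)
  (pendant : ∀ {u v} → E u v → OnlyNeighbour E u v ⊎ OnlyNeighbour E v u) where

  pendant-neighbour-isStarCentre : ∀ {p x} → OnlyNeighbour E p x → E x p → IsStarCentre E x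
  pendant-neighbour-isStarCentre p→x xp {y} xy {z} yz with pendant xy
  ... | inj₁ x→y = p→x (subst (λ v → E v z) (≡.sym (x→y xp)) yz)
  ... | inj₂ y→x = y→x yz

  starCentre : ∀ {u v} → E u v → ∃[ x ] (IsStarCentre E x × ClosedNbhd E x u × ∃[ y ] E x y)
  starCentre uv with pendant uv
  ... | inj₁ u→v = _ , pendant-neighbour-isStarCentre u→v (E-sym uv) , inj₂ (E-sym uv) , _ , E-sym uv
  ... | inj₂ v→u = _ , pendant-neighbour-isStarCentre v→u uv , inj₁ refl , _ , uv

  ClosedNbhd⇒Star : ∀ {x u} → ClosedNbhd E x u → Star E u x
  ClosedNbhd⇒Star (inj₁ refl) = ε
  ClosedNbhd⇒Star (inj₂ xu)   = E-sym xu ◅ ε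

  component-isStar : ∀ {u v} → E u v → IsStar E (Star E u)
  component-isStar uv with starCentre uv
  ... | x , centre , u∈N , y , xy =
    x , ClosedNbhd⇒Star u∈N , (λ _ → Star-preserves-ClosedNbhd E centre u∈N) ,
    y , ClosedNbhd⇒Star u∈N ◅◅ (xy ◅ ε) , xy

  ClosedNbhd⇒withinTwoSteps : ∀ {x u v} → ClosedNbhd E x u → ClosedNbhd E x v → WithinTwoSteps E u v
  ClosedNbhd⇒withinTwoSteps (inj₁ refl) (inj₁ refl) = inj₁ refl
  ClosedNbhd⇒withinTwoSteps (inj₁ refl) (inj₂ xv)   = inj₂ (inj₁ xv)
  ClosedNbhd⇒withinTwoSteps (inj₂ xu)   (inj₁ refl) = inj₂ (inj₁ (E-sym xu))
  ClosedNbhd⇒withinTwoSteps (inj₂ xu)   (inj₂ xv)   = inj₂ (inj₂ (_ , E-sym xu , xv))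

  Star⇒withinTwoSteps : ∀ {u v} → Star E u v → WithinTwoSteps E u v
  Star⇒withinTwoSteps ε = inj₁ refl
  Star⇒withinTwoSteps (uy ◅ w) with starCentre uy
  ... | x , centre , u∈N , _ =
    ClosedNbhd⇒withinTwoSteps u∈N (Star-preserves-ClosedNbhd E centre u∈N (uy ◅ w))

i+1-1≡i : ∀ i → i + 1ℤ + -1ℤ ≡ i
i+1-1≡i i = ≡.trans (+-assoc i 1ℤ -1ℤ) (+-identityʳ i)

i-1+1≡i : ∀ i → i + -1ℤ + 1ℤ ≡ i
i-1+1≡i i = ≡.trans (+-assoc i -1ℤ 1ℤ) (+-identityʳ i)

Adj-sym : Symmetric Adj
Adj-sym {x , _} (inj₁ (refl , refl))               = inj₂ (inj₁ (≡.sym (i+1-1≡i x) , refl))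
Adj-sym {x , _} (inj₂ (inj₁ (refl , refl)))        = inj₁ (≡.sym (i-1+1≡i x) , refl)
Adj-sym {_ , y} (inj₂ (inj₂ (inj₁ (refl , refl)))) = inj₂ (inj₂ (inj₂ (refl , ≡.sym (i+1-1≡i y))))
Adj-sym {_ , y} (inj₂ (inj₂ (inj₂ (refl , refl)))) = inj₂ (inj₂ (inj₁ (refl , ≡.sym (i-1+1≡i y))))

_≟ᶜ_ : DecidableEquality Cell
_≟ᶜ_ = ≡-dec ℤ._≟_ ℤ._≟_

-- Edge C u v unfolds to ∃[ D ] (D ∈ C × Joins D u v).
Joins : Domino → Cell → Cell → Set
Joins ((p , q) , _) u v = (p ≡ u × q ≡ v) ⊎ (p ≡ v × q ≡ u)

Joins? : ∀ D → Decidable (Joins D)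
Joins? ((p , q) , _) u v = ((p ≟ᶜ u) ×-dec (q ≟ᶜ v)) ⊎-dec ((p ≟ᶜ v) ×-dec (q ≟ᶜ u))

Joins-sym : ∀ D {u v} → Joins D u v → Joins D v u
Joins-sym _ = Sum.swap

Joins-functional : ∀ D {u v w} → Joins D u v → Joins D u w → v ≡ w
Joins-functional _ (inj₁ (refl , refl)) (inj₁ (refl , refl)) = refl
Joins-functional _ (inj₁ (refl , refl)) (inj₂ (refl , refl)) = refl
Joins-functional _ (inj₂ (refl , refl)) (inj₁ (refl , refl)) = refl
Joins-functional _ (inj₂ (refl , refl)) (inj₂ (refl , refl)) = refl

Joins⇒InDomino : ∀ D {u v} → Joins D u v → InDomino u D
Joins⇒InDomino _ (inj₁ (refl , _)) = inj₁ refl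
Joins⇒InDomino _ (inj₂ (_ , refl)) = inj₂ refl

InDomino-Joins : ∀ D {u v c} → Joins D u v → InDomino c D → c ≡ u ⊎ c ≡ v
InDomino-Joins _ (inj₁ (refl , refl)) c∈D = c∈D
InDomino-Joins _ (inj₂ (refl , refl)) c∈D = Sum.swap c∈D

module _ {C : List Domino} where

  Edge-sym : Symmetric (Edge C)
  Edge-sym (D , D∈C , uv) = D , D∈C , Joins-sym D uv

  Edge⇒Adj : Edge C ⇒ Adj
  Edge⇒Adj (((_ , _) , adj) , _ , inj₁ (refl , refl)) = adj
  Edge⇒Adj (((_ , _) , adj) , _ , inj₂ (refl , refl)) = Adj-sym adj

  Edge? : Decidable (Edge C)
  Edge? u v = map′ find (λ (_ , D∈C , uv) → lose D∈C uv) (any? (λ D → Joins? D u v) C)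

  InDomino⇒Edge : ∀ {D c} → D ∈ C → InDomino c D → ∃[ d ] Edge C c d
  InDomino⇒Edge D∈C (inj₁ refl) = _ , _ , D∈C , inj₁ (refl , refl)
  InDomino⇒Edge D∈C (inj₂ refl) = _ , _ , D∈C , inj₂ (refl , refl)

CoveredOnlyBy : List Domino → Domino → Cell → Set
CoveredOnlyBy C D c = ∀ {D′} → D′ ∈ C → InDomino c D′ → D′ ≡ D

saturated⇒privateCell : ∀ {B C D} → IsCovering B C → IsSaturated B C → D ∈ C →
  ∃[ c ] (InDomino c D × CoveredOnlyBy C D c)
saturated⇒privateCell {C = C} (_ , covers) sat D∈C with sat (Any.index D∈C)
... | c , c∈B , uncovered with covers c c∈B
...   | D′ , D′∈C , c∈D′ = c , subst (InDomino c) (onlyD D′∈C c∈D′) c∈D′ , onlyD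
  where
  onlyD : CoveredOnlyBy C _ c
  onlyD D″∈C c∈D″ with ∈-removeAt⁻ D″∈C (Any.index D∈C)
  ... | inj₁ D″≡Dᵢ = ≡.trans D″≡Dᵢ (≡.sym (Anyₚ.lookup-index D∈C))
  ... | inj₂ D″∈rest = ⊥-elim (uncovered (_ , D″∈rest , c∈D″))

privateCell⇒onlyNeighbour : ∀ {C D u v} → CoveredOnlyBy C D u → Joins D u v → OnlyNeighbour (Edge C) u v
privateCell⇒onlyNeighbour {D = D} onlyD uv (D′ , D′∈C , uw) with onlyD D′∈C (Joins⇒InDomino D′ uw)
... | refl = Joins-functional D uw uv

saturated⇒pendant : ∀ {B C} → IsCovering B C → IsSaturated B C →
  ∀ {u v} → Edge C u v → OnlyNeighbour (Edge C) u v ⊎ OnlyNeighbour (Edge C) v u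
saturated⇒pendant cov sat (D , D∈C , uv) with saturated⇒privateCell cov sat D∈C
... | c , c∈D , onlyD with InDomino-Joins D uv c∈D
...   | inj₁ refl = inj₁ (privateCell⇒onlyNeighbour onlyD uv)
...   | inj₂ refl = inj₂ (privateCell⇒onlyNeighbour onlyD (Joins-sym D uv))

module SaturatedCovering {B C} (cov : IsCovering B C) (sat : IsSaturated B C) where

  open PendantEdges (Edge-sym {C}) (saturated⇒pendant cov sat)

  Edge⇒∈ : ∀ {u v} → Edge C u v → v ∈ B
  Edge⇒∈ (D , D∈C , uv) = proj₁ cov D D∈C _ (Joins⇒InDomino D (Joins-sym D uv))

  Connected-preserves-∈ : ∀ {u v} → u ∈ B → Connected C u v → v ∈ B
  Connected-preserves-∈ u∈B ε        = u∈B
  Connected-preserves-∈ _   (uy ◅ w) = Connected-preserves-∈ (Edge⇒∈ uy) w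

  Connected? : Decidable (Connected C)
  Connected? u v =
    map′ (withinTwoSteps⇒Star (Edge C)) Star⇒withinTwoSteps ((u ≟ᶜ v) ⊎-dec Edge? u v ⊎-dec twoSteps?)
    where
    -- The middle vertex of a two-step walk is in B, so searching B suffices.
    twoSteps? : Dec (∃[ y ] (Edge C u y × Edge C y v))
    twoSteps? = map′ (map₂ proj₂ ∘ find) (λ (_ , uy , yv) → lose (Edge⇒∈ uy) (uy , yv))
                     (any? (λ y → Edge? u y ×-dec Edge? y v) B)

  connectivity : DecSetoid 0ℓ 0ℓ
  connectivity = record
    { Carrier          = Cell
    ; _≈_              = Connected C
    ; isDecEquivalence = record
      { isEquivalence = record { refl = ε ; sym = reverse Edge-sym ; trans = _◅◅_ }
      ; _≟_           = Connected?
      }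
    }

  component-isFragment : ∀ {c} → c ∈ B → IsFragment (Component C c)
  component-isFragment c∈B with proj₂ cov _ c∈B
  ... | _ , D∈C , c∈D = IsStar-mono Edge⇒Adj (component-isStar (proj₂ (InDomino⇒Edge D∈C c∈D)))

-- Having a domino covering already makes B a board.
mainTheorem1 : (B : List Cell) (C : List Domino) →
    IsBoard B → IsCovering B C → IsSaturated B C →
    (∀ c → c ∈ B → IsFragment (Component C c)) ×
    ∃[ L ] (IsFragmentDecomposition B L × (∀ i → ∃[ c ] (c ∈ B × (∀ d → Component C c d → lookup L i d) × (∀ d → lookup L i d → Component C c d))))
mainTheorem1 B C _ cov sat =
  (λ _ → component-isFragment) ,
  classes B ,
  (fragment , inBoard , (λ _ → classes-cover) , classes-disjoint B) ,
  represented
  where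
  open SaturatedCovering cov sat
  open EquivalenceClasses connectivity

  represented : ∀ i → ∃[ c ] (c ∈ B × (∀ d → Component C c d → lookup (classes B) i d)
                                    × (∀ d → lookup (classes B) i d → Component C c d))
  represented i with classes-represented B i
  ... | c , c∈B , eq = c , c∈B , (λ d → subst (λ F → F d) (≡.sym eq)) , (λ d → subst (λ F → F d) eq)

  fragment : ∀ i → IsFragment (lookup (classes B) i)
  fragment i with classes-represented B i
  ... | c , c∈B , eq = subst IsFragment (≡.sym eq) (component-isFragment c∈B)

  inBoard : ∀ i c → lookup (classes B) i c → c ∈ B
  inBoard i d dᵢ with represented i
  ... | c , c∈B , _ , toC = Connected-preserves-∈ c∈B (toC d dᵢ)
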